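{- For all integers $k \geq 2$, $$h^*(2k, k) \leq \left(1 - \frac{k}{4(k+2)}\right)\binom{2k}{k}.$$
   Context: For a $k$-uniform hypergraph $H$ with vertex set $V$ and $1 \le m \le k-1$: an $m$-matching is a set $M$ of edges with $|e \cap e'| < m$ for all distinct $e,e' \in M$, and $\nu^{(m)}(H)$ is its maximum size. A fractional $m$-cover is a function $c:\binom{V}{m} \to \mathbb{R}_{\ge 0}$ such that $\sum_{S \in \binom{e}{m}} c(S) \geq 1$ for every edge $e$; its size is $\sum_S c(S)$, and $\tau^{*(m)}(H)$ is the minimum size of a fractional $m$-cover. $h^*(k,m)$ is the supremum of $\tau^{*(m)}(H)/\nu^{(m)}(H)$ over all finite $k$-uniform hypergraphs $H$ with at least one edge. -}

module Defs where

open import Data.Nat using (ℕ; zero; suc; _+_; _*_; _<_)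
open import Data.Nat.Combinatorics using (_C_)
open import Data.Bool using (Bool; true)
open import Data.Fin.Subset using (Subset; inside; outside; _∩_; _⊆_; ∣_∣)
open import Data.Fin.Subset.Properties using (_⊆?_)
open import Data.List using (List; []; _∷_; _++_; map; filter; foldr; length)
open import Data.List.Relation.Unary.All using (All)
open import Data.List.Relation.Unary.AllPairs using (AllPairs)
open import Data.Vec using (Vec; []; _∷_)
open import Data.Product using (Σ; ∃; _×_)
open import Relation.Binary.PropositionalEquality using (_≡_; _≢_)
open import Data.Integer using (+_)
import Data.Nat as ℕ
open import Data.Rational using (ℚ; 0ℚ; 1ℚ; _-_; _/_; _≤_) renaming (_+_ to _+ℚ_; _*_ to _*ℚ_)

Hypergraph : ℕ → Set
Hypergraph n = Subset n → Bool

IsEdge : ∀ {n} → Hypergraph n → Subset n → Set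
IsEdge E e = E e ≡ true

Uniform : ∀ {n} → ℕ → Hypergraph n → Set
Uniform k E = ∀ e → IsEdge E e → ∣ e ∣ ≡ k

HasEdge : ∀ {n} → Hypergraph n → Set
HasEdge E = ∃ λ e → IsEdge E e

IsMatching : ∀ {n} → ℕ → Hypergraph n → List (Subset n) → Set
IsMatching m E M = All (IsEdge E) M × AllPairs (λ e e′ → e ≢ e′ × ∣ e ∩ e′ ∣ < m) M

IsMaxMatchingSize : ∀ {n} → ℕ → Hypergraph n → ℕ → Set
IsMaxMatchingSize m E ν =
  (Σ (List (Subset _)) λ M → IsMatching m E M × length M ≡ ν)
  × (∀ M → IsMatching m E M → length M ℕ.≤ ν)

allSubsets : (n : ℕ) → List (Subset n)
allSubsets zero = [] ∷ []
allSubsets (suc n) = map (inside ∷_) (allSubsets n) ++ map (outside ∷_) (allSubsets n)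

sumℚ : List ℚ → ℚ
sumℚ = foldr _+ℚ_ 0ℚ

mSubsets : (n m : ℕ) → List (Subset n)
mSubsets n m = filter (λ S → ∣ S ∣ ℕ.≟ m) (allSubsets n)

mSubsetsOf : ∀ {n} → ℕ → Subset n → List (Subset n)
mSubsetsOf {n} m e = filter (λ S → S ⊆? e) (mSubsets n m)

-- fractional m-cover (values only on m-sets matter)
IsFractionalCover : ∀ {n} → ℕ → Hypergraph n → (Subset n → ℚ) → Set
IsFractionalCover m E c =
  (∀ S → 0ℚ ≤ c S) × (∀ e → IsEdge E e → 1ℚ ≤ sumℚ (map c (mSubsetsOf m e)))

coverSize : ∀ {n} → ℕ → (Subset n → ℚ) → ℚ
coverSize {n} m c = sumℚ (map c (mSubsets n m))

bound : ℕ → ℚ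
bound k = (1ℚ - (+ k) / (4 * (2 + k))) *ℚ ((+ ((2 * k) C k)) / 1)

ℕtoℚ : ℕ → ℚ
ℕtoℚ a = (+ a) / 1

{-# OPTIONS --safe #-}
module Submission where

-- Fix a maximum k-matching M, so ν = |M|.  Every k-subset A of every f ∈ M gets weight 1/2, plus
-- a further 1/4 placed on a k-set bonus f A.  The total is (3/4)·C(2k,k)·ν, within the claimed
-- bound since k/(k+2) ≤ 1; only k ≥ 1 is used, and E need not have an edge.  Let e be an edge.
-- By maximality e meets some f ∈ M in at least k vertices.  If it meets two of them, or one in
-- more than k vertices, it contains two k-sets of weight 1/2.  Otherwise e is anchored at f along
-- the k-set A = e ∩ f: f is the only edge of M meeting e in at least k vertices.  If x is anchored
-- along A and y along f ∖ A, then x, y and M ∖ f would form a larger matching unless |x ∩ y| ≥ k,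
-- which forces x ∖ f = y ∖ f.  So the bonuses of A and of f ∖ A can both go to this common k-set
-- (or to the anchor set of the only side having anchored edges), and e receives 1/2 + 1/4 + 1/4.
-- Weights are counted in quarters, as natural numbers, until the final step.

open import Defs
open import Data.Bool as Bool using (true; false; if_then_else_)
open import Data.Bool.Properties using (∧-zeroʳ)
open import Data.Nat using (ℕ; zero; suc; _+_; _*_; _≤_; _<_; _⊔_; _≤?_; _<?_; z≤n; s≤s; s≤s⁻¹)
import Data.Nat as ℕ
open import Data.Nat.Properties
open import Algebra.Properties.CommutativeSemigroup +-commutativeSemigroup
  using () renaming (interchange to +-interchange)
open import Data.Nat.Combinatorics using (_C_; nCk+nC[k+1]≡[n+1]C[k+1])
import Data.Nat.Coprimality as Coprime
open import Data.Nat.ListAction using (sum)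
open import Data.Nat.ListAction.Properties using (sum-++)
open import Data.Integer as ℤ using (+≤+)
import Data.Integer.Properties as ℤ
open import Data.Rational using (ℚ; mkℚ; 0ℚ; 1ℚ; _/_; NonNegative; *≤*)
  renaming (_+_ to _+ℚ_; _*_ to _*ℚ_; _-_ to _-ℚ_; _≤_ to _≤ℚ_)
import Data.Rational.Properties as ℚ
import Data.Rational.Unnormalised as ℚᵘ
import Data.Rational.Unnormalised.Properties as ℚᵘ
open import Data.Vec using ([]; _∷_; here; tail)
open import Data.Vec.Properties using () renaming (≡-dec to Vec-≡-dec)
open import Data.Fin.Subset using (Subset; inside; outside; _∩_; ∁; _⊆_; ∣_∣; ⊥)
open import Data.Fin.Subset.Properties
  using (_⊆?_; anySubset?; ⊆-trans; out⊆; in⊆in; drop-∷-⊆; ⊥⊆; ∣⊥∣≡0; ∩-idem; p∩q⊆p; p∩q⊆q; ∣p∩q∣≤∣p∣; ∣p∩q∣≤∣q∣)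
open import Data.List using (List; []; _∷_; _++_; map; filter; length)
open import Data.List.Properties using (map-++; map-∘; map-cong) renaming (≡-dec to List-≡-dec)
open import Data.List.Membership.Propositional using (_∈_; _∉_)
open import Data.List.Membership.Propositional.Properties using (∈-map⁺; ∈-map⁻; ∈-++⁺ˡ; ∈-++⁺ʳ; ∈-filter⁺; ∈-filter⁻)
open import Data.List.Relation.Unary.Any using (here; there)
open import Data.List.Relation.Unary.Any.Properties using (¬Any[])
open import Data.List.Relation.Unary.All using (All; []; _∷_)
import Data.List.Relation.Unary.All as All
open import Data.List.Relation.Unary.AllPairs using (AllPairs; []; _∷_)
import Data.List.Relation.Unary.AllPairs as AllPairs
import Data.List.Relation.Unary.AllPairs.Properties as AllPairs
open import Data.List.Relation.Unary.Unique.Propositional using (Unique)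
import Data.List.Relation.Unary.Unique.Propositional.Properties as Unique
open import Data.Product using (Σ; ∃; ∃₂; _×_; _,_; proj₁; proj₂)
open import Function using (_∘_)
open import Relation.Binary.Definitions using (DecidableEquality)
open import Relation.Binary.PropositionalEquality
open import Relation.Nullary using (¬_; Dec; yes; no; does; contradiction)
open import Relation.Nullary.Decidable using (_×-dec_)
open import Relation.Unary using (Pred; Decidable)
open import Relation.Unary.Properties using (∁?)

private variable
  n : ℕ

-- Indicators and finite sums over lists

-- Defined through `does`, so that 𝟙 of a ×-dec, or of _⊆?_ on a cons, reduces definitionally.
𝟙 : ∀ {p} {P : Set p} → Dec P → ℕ
𝟙 d = if does d then 1 else 0

𝟙≤1 : ∀ {p} {P : Set p} (d : Dec P) → 𝟙 d ≤ 1
𝟙≤1 (yes _) = ≤-refl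
𝟙≤1 (no _)  = z≤n

𝟙≡1 : ∀ {p} {P : Set p} (d : Dec P) → P → 𝟙 d ≡ 1
𝟙≡1 (yes _) _  = refl
𝟙≡1 (no ¬p) p = contradiction p ¬p

module _ {a} {A : Set a} where

  ∑ : (A → ℕ) → List A → ℕ
  ∑ f xs = sum (map f xs)

  ∑-cong : ∀ {f g : A → ℕ} → (∀ x → f x ≡ g x) → ∀ xs → ∑ f xs ≡ ∑ g xs
  ∑-cong f≗g xs = cong sum (map-cong f≗g xs)

  ∑-++ : ∀ (f : A → ℕ) xs ys → ∑ f (xs ++ ys) ≡ ∑ f xs + ∑ f ys
  ∑-++ f xs ys = trans (cong sum (map-++ f xs ys)) (sum-++ (map f xs) (map f ys))

  ∑-+ : ∀ (f g : A → ℕ) xs → ∑ (λ x → f x + g x) xs ≡ ∑ f xs + ∑ g xs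
  ∑-+ f g [] = refl
  ∑-+ f g (x ∷ xs) =
    trans (cong (f x + g x +_) (∑-+ f g xs)) (+-interchange (f x) (g x) (∑ f xs) (∑ g xs))

  ∑-*ˡ : ∀ c (f : A → ℕ) xs → ∑ (λ x → c * f x) xs ≡ c * ∑ f xs
  ∑-*ˡ c f [] = sym (*-zeroʳ c)
  ∑-*ˡ c f (x ∷ xs) = trans (cong (c * f x +_) (∑-*ˡ c f xs)) (sym (*-distribˡ-+ c (f x) (∑ f xs)))

  ∑-zero : ∀ {f : A → ℕ} → (∀ x → f x ≡ 0) → ∀ xs → ∑ f xs ≡ 0
  ∑-zero f≗0 [] = refl
  ∑-zero f≗0 (x ∷ xs) = cong₂ _+_ (f≗0 x) (∑-zero f≗0 xs)

  ∑-bounded : ∀ {f : A → ℕ} {c} xs → (∀ {x} → x ∈ xs → f x ≤ c) → ∑ f xs ≤ c * length xs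
  ∑-bounded {c = c} [] f≤c = ≤-reflexive (sym (*-zeroʳ c))
  ∑-bounded {f = f} {c} (x ∷ xs) f≤c = begin
    f x + ∑ f xs        ≤⟨ +-mono-≤ (f≤c (here refl)) (∑-bounded xs (f≤c ∘ there)) ⟩
    c + c * length xs   ≡⟨ *-suc c (length xs) ⟨
    c * suc (length xs) ∎
    where open ≤-Reasoning

  ∈⇒≤∑ : ∀ (f : A → ℕ) {x xs} → x ∈ xs → f x ≤ ∑ f xs
  ∈⇒≤∑ f (here refl) = m≤m+n _ _
  ∈⇒≤∑ f {xs = y ∷ _} (there x∈xs) = ≤-trans (∈⇒≤∑ f x∈xs) (m≤n+m _ (f y))

  ∑-pair : ∀ (f : A → ℕ) {x y xs} → Unique xs → x ∈ xs → y ∈ xs → x ≢ y → f x + f y ≤ ∑ f xs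
  ∑-pair f _ (here refl) (here refl) x≢y = contradiction refl x≢y
  ∑-pair f _ (here refl) (there y∈xs) _ = +-monoʳ-≤ (f _) (∈⇒≤∑ f y∈xs)
  ∑-pair f {x} {y} {_ ∷ xs} _ (there x∈xs) (here refl) _ =
    subst (_≤ f y + ∑ f xs) (+-comm (f y) (f x)) (+-monoʳ-≤ (f y) (∈⇒≤∑ f x∈xs))
  ∑-pair f {xs = z ∷ _} (_ ∷ xs!) (there x∈xs) (there y∈xs) x≢y =
    ≤-trans (∑-pair f xs! x∈xs y∈xs x≢y) (m≤n+m _ (f z))

  length-filter-filter : ∀ {p q} {P : Pred A p} {Q : Pred A q} (P? : Decidable P) (Q? : Decidable Q) xs →
    length (filter Q? (filter P? xs)) ≡ ∑ (λ x → 𝟙 (Q? x ×-dec P? x)) xs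
  length-filter-filter P? Q? [] = refl
  length-filter-filter P? Q? (x ∷ xs) with does (P? x)
  ... | false with does (Q? x)
  ...   | false = length-filter-filter P? Q? xs
  ...   | true  = length-filter-filter P? Q? xs
  length-filter-filter P? Q? (x ∷ xs) | true with does (Q? x)
  ...   | false = length-filter-filter P? Q? xs
  ...   | true  = cong suc (length-filter-filter P? Q? xs)

  length-filter+length-filter-∁ : ∀ {p} {P : Pred A p} (P? : Decidable P) xs →
    length (filter P? xs) + length (filter (∁? P?) xs) ≡ length xs
  length-filter+length-filter-∁ P? [] = refl
  length-filter+length-filter-∁ P? (x ∷ xs) with does (P? x)
  ... | true  = cong suc (length-filter+length-filter-∁ P? xs)
  ... | false = trans (+-suc _ _) (cong suc (length-filter+length-filter-∁ P? xs))

module _ {a b} {A : Set a} {B : Set b} where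

  ∑-map : ∀ (f : B → ℕ) (g : A → B) xs → ∑ f (map g xs) ≡ ∑ (f ∘ g) xs
  ∑-map f g xs = cong sum (sym (map-∘ xs))

  ∑-comm : ∀ (h : A → B → ℕ) xs ys → ∑ (λ x → ∑ (h x) ys) xs ≡ ∑ (λ y → ∑ (λ x → h x y) xs) ys
  ∑-comm h [] ys = sym (∑-zero (λ _ → refl) ys)
  ∑-comm h (x ∷ xs) ys = trans (cong (∑ (h x) ys +_) (∑-comm h xs ys)) (sym (∑-+ (h x) _ ys))

module _ {a} {A : Set a} (_≟_ : DecidableEquality A) where

  open import Data.List.Membership.DecPropositional _≟_ using (_∈?_)

  ∑-𝟙-≟ : ∀ x {xs} → Unique xs → ∑ (λ y → 𝟙 (x ≟ y)) xs ≡ 𝟙 (x ∈? xs)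
  ∑-𝟙-≟ x {[]} [] = refl
  ∑-𝟙-≟ x {y ∷ xs} (y∉xs ∷ xs!) with x ≟ y
  ... | no _     = ∑-𝟙-≟ x xs!
  ... | yes refl = cong suc (trans (∑-𝟙-≟ x xs!) (x∉xs (x ∈? xs)))
    where
    x∉xs : (d : Dec (x ∈ xs)) → 𝟙 d ≡ 0
    x∉xs (yes x∈xs) = contradiction refl (All.lookup y∉xs x∈xs)
    x∉xs (no _)     = refl

-- Subsets of Fin n

∣p∣≡∣p∩q∣+∣p∩∁q∣ : ∀ (p q : Subset n) → ∣ p ∣ ≡ ∣ p ∩ q ∣ + ∣ p ∩ ∁ q ∣
∣p∣≡∣p∩q∣+∣p∩∁q∣ []            []            = refl
∣p∣≡∣p∩q∣+∣p∩∁q∣ (inside  ∷ p) (inside  ∷ q) = cong suc (∣p∣≡∣p∩q∣+∣p∩∁q∣ p q)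
∣p∣≡∣p∩q∣+∣p∩∁q∣ (inside  ∷ p) (outside ∷ q) = trans (cong suc (∣p∣≡∣p∩q∣+∣p∩∁q∣ p q)) (sym (+-suc _ _))
∣p∣≡∣p∩q∣+∣p∩∁q∣ (outside ∷ p) (_       ∷ q) = ∣p∣≡∣p∩q∣+∣p∩∁q∣ p q

∣p∩q∣≡∣p∩r∩q∩r∣+∣p∩∁r∩q∩∁r∣ : ∀ (p q r : Subset n) → ∣ p ∩ q ∣ ≡ ∣ (p ∩ r) ∩ (q ∩ r) ∣ + ∣ (p ∩ ∁ r) ∩ (q ∩ ∁ r) ∣
∣p∩q∣≡∣p∩r∩q∩r∣+∣p∩∁r∩q∩∁r∣ []            []            []            = refl
∣p∩q∣≡∣p∩r∩q∩r∣+∣p∩∁r∩q∩∁r∣ (inside  ∷ p) (inside  ∷ q) (inside  ∷ r) = cong suc (∣p∩q∣≡∣p∩r∩q∩r∣+∣p∩∁r∩q∩∁r∣ p q r)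
∣p∩q∣≡∣p∩r∩q∩r∣+∣p∩∁r∩q∩∁r∣ (inside  ∷ p) (inside  ∷ q) (outside ∷ r) =
  trans (cong suc (∣p∩q∣≡∣p∩r∩q∩r∣+∣p∩∁r∩q∩∁r∣ p q r)) (sym (+-suc _ _))
∣p∩q∣≡∣p∩r∩q∩r∣+∣p∩∁r∩q∩∁r∣ (inside  ∷ p) (outside ∷ q) (inside  ∷ r) = ∣p∩q∣≡∣p∩r∩q∩r∣+∣p∩∁r∩q∩∁r∣ p q r
∣p∩q∣≡∣p∩r∩q∩r∣+∣p∩∁r∩q∩∁r∣ (inside  ∷ p) (outside ∷ q) (outside ∷ r) = ∣p∩q∣≡∣p∩r∩q∩r∣+∣p∩∁r∩q∩∁r∣ p q r
∣p∩q∣≡∣p∩r∩q∩r∣+∣p∩∁r∩q∩∁r∣ (outside ∷ p) (_       ∷ q) (inside  ∷ r) = ∣p∩q∣≡∣p∩r∩q∩r∣+∣p∩∁r∩q∩∁r∣ p q r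
∣p∩q∣≡∣p∩r∩q∩r∣+∣p∩∁r∩q∩∁r∣ (outside ∷ p) (_       ∷ q) (outside ∷ r) = ∣p∩q∣≡∣p∩r∩q∩r∣+∣p∩∁r∩q∩∁r∣ p q r

p⊆q⇒q∩p≡p : ∀ {p q : Subset n} → p ⊆ q → q ∩ p ≡ p
p⊆q⇒q∩p≡p {p = []}          {[]}          _   = refl
p⊆q⇒q∩p≡p {p = inside  ∷ p} {inside  ∷ q} p⊆q = cong (inside ∷_) (p⊆q⇒q∩p≡p (drop-∷-⊆ p⊆q))
p⊆q⇒q∩p≡p {p = inside  ∷ p} {outside ∷ q} p⊆q with () ← p⊆q here
p⊆q⇒q∩p≡p {p = outside ∷ p} {inside  ∷ q} p⊆q = cong (outside ∷_) (p⊆q⇒q∩p≡p (drop-∷-⊆ p⊆q))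
p⊆q⇒q∩p≡p {p = outside ∷ p} {outside ∷ q} p⊆q = cong (outside ∷_) (p⊆q⇒q∩p≡p (drop-∷-⊆ p⊆q))

p⊆q⇒q∩∁[q∩∁p]≡p : ∀ {p q : Subset n} → p ⊆ q → q ∩ ∁ (q ∩ ∁ p) ≡ p
p⊆q⇒q∩∁[q∩∁p]≡p {p = []}          {[]}          _   = refl
p⊆q⇒q∩∁[q∩∁p]≡p {p = inside  ∷ p} {inside  ∷ q} p⊆q = cong (inside ∷_) (p⊆q⇒q∩∁[q∩∁p]≡p (drop-∷-⊆ p⊆q))
p⊆q⇒q∩∁[q∩∁p]≡p {p = inside  ∷ p} {outside ∷ q} p⊆q with () ← p⊆q here
p⊆q⇒q∩∁[q∩∁p]≡p {p = outside ∷ p} {inside  ∷ q} p⊆q = cong (outside ∷_) (p⊆q⇒q∩∁[q∩∁p]≡p (drop-∷-⊆ p⊆q))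
p⊆q⇒q∩∁[q∩∁p]≡p {p = outside ∷ p} {outside ∷ q} p⊆q = cong (outside ∷_) (p⊆q⇒q∩∁[q∩∁p]≡p (drop-∷-⊆ p⊆q))

p∩q∩∁p≡⊥ : ∀ (p q : Subset n) → p ∩ (q ∩ ∁ p) ≡ ⊥
p∩q∩∁p≡⊥ []            []            = refl
p∩q∩∁p≡⊥ (inside  ∷ p) (inside  ∷ q) = cong (outside ∷_) (p∩q∩∁p≡⊥ p q)
p∩q∩∁p≡⊥ (inside  ∷ p) (outside ∷ q) = cong (outside ∷_) (p∩q∩∁p≡⊥ p q)
p∩q∩∁p≡⊥ (outside ∷ p) (_       ∷ q) = cong (outside ∷_) (p∩q∩∁p≡⊥ p q)

p≢q∩∁p : ∀ {p : Subset n} q → 0 < ∣ p ∣ → p ≢ q ∩ ∁ p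
p≢q∩∁p {n} {p} q 0<∣p∣ p≡q∩∁p = <⇒≢ 0<∣p∣ (sym (begin
  ∣ p ∣           ≡⟨ cong ∣_∣ (∩-idem p) ⟨
  ∣ p ∩ p ∣       ≡⟨ cong (λ r → ∣ p ∩ r ∣) p≡q∩∁p ⟩
  ∣ p ∩ (q ∩ ∁ p) ∣ ≡⟨ cong ∣_∣ (p∩q∩∁p≡⊥ p q) ⟩
  ∣ ⊥ {n} ∣       ≡⟨ ∣⊥∣≡0 n ⟩
  0               ∎))
  where open ≡-Reasoning

∣p∣⊔∣q∣≤∣p∩q∣⇒p≡q : ∀ {p q : Subset n} → ∣ p ∣ ⊔ ∣ q ∣ ≤ ∣ p ∩ q ∣ → p ≡ q
∣p∣⊔∣q∣≤∣p∩q∣⇒p≡q {p = p} {q} ≤∣p∩q∣ = go p q (≤-trans (m≤m⊔n _ _) ≤∣p∩q∣) (≤-trans (m≤n⊔m _ _) ≤∣p∩q∣)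
  where
  go : ∀ {n} (p q : Subset n) → ∣ p ∣ ≤ ∣ p ∩ q ∣ → ∣ q ∣ ≤ ∣ p ∩ q ∣ → p ≡ q
  go []            []            _ _ = refl
  go (inside  ∷ p) (inside  ∷ q) a b = cong (inside ∷_) (go p q (s≤s⁻¹ a) (s≤s⁻¹ b))
  go (inside  ∷ p) (outside ∷ q) a _ = contradiction (≤-trans a (∣p∩q∣≤∣p∣ p q)) 1+n≰n
  go (outside ∷ p) (inside  ∷ q) _ b = contradiction (≤-trans b (∣p∩q∣≤∣q∣ p q)) 1+n≰n
  go (outside ∷ p) (outside ∷ q) a b = cong (outside ∷_) (go p q a b)

subset-of-size : ∀ {m} (p : Subset n) → m ≤ ∣ p ∣ → ∃ λ q → q ⊆ p × ∣ q ∣ ≡ m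
subset-of-size {n} {m = zero} p _ = ⊥ , ⊥⊆ , ∣⊥∣≡0 n
subset-of-size {m = suc m} (outside ∷ p) m≤∣p∣ with q , q⊆p , ∣q∣≡m ← subset-of-size p m≤∣p∣ =
  outside ∷ q , out⊆ q⊆p , ∣q∣≡m
subset-of-size {m = suc m} (inside  ∷ p) m≤∣p∣ with q , q⊆p , ∣q∣≡m ← subset-of-size p (s≤s⁻¹ m≤∣p∣) =
  inside ∷ q , in⊆in q⊆p , cong suc ∣q∣≡m

two-subsets-of-size : ∀ {m} (p : Subset n) → 0 < m → m < ∣ p ∣ →
  ∃₂ λ q r → q ≢ r × (q ⊆ p × ∣ q ∣ ≡ m) × (r ⊆ p × ∣ r ∣ ≡ m)
two-subsets-of-size (outside ∷ p) 0<m m<∣p∣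
  with q , r , q≢r , (q⊆p , ∣q∣≡m) , (r⊆p , ∣r∣≡m) ← two-subsets-of-size p 0<m m<∣p∣ =
  outside ∷ q , outside ∷ r , q≢r ∘ cong tail , (out⊆ q⊆p , ∣q∣≡m) , (out⊆ r⊆p , ∣r∣≡m)
two-subsets-of-size {m = suc m} (inside ∷ p) _ m<∣p∣
  with q , q⊆p , ∣q∣≡m ← subset-of-size p (s≤s⁻¹ m<∣p∣)
     | r , r⊆p , ∣r∣≡m ← subset-of-size p (≤-trans (n≤1+n m) (s≤s⁻¹ m<∣p∣)) =
  outside ∷ q , inside ∷ r , (λ ()) , (out⊆ q⊆p , ∣q∣≡m) , (in⊆in r⊆p , cong suc ∣r∣≡m)

-- Enumerating and counting subsets

∈-allSubsets : ∀ (p : Subset n) → p ∈ allSubsets n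
∈-allSubsets []            = here refl
∈-allSubsets (inside  ∷ p) = ∈-++⁺ˡ (∈-map⁺ (inside ∷_) (∈-allSubsets p))
∈-allSubsets (outside ∷ p) = ∈-++⁺ʳ _ (∈-map⁺ (outside ∷_) (∈-allSubsets p))

allSubsets-unique : ∀ n → Unique (allSubsets n)
allSubsets-unique zero    = [] ∷ []
allSubsets-unique (suc n) =
  Unique.++⁺ (Unique.map⁺ (cong tail) (allSubsets-unique n)) (Unique.map⁺ (cong tail) (allSubsets-unique n)) disjoint
  where
  disjoint : ∀ {p} → ¬ (p ∈ map (inside ∷_) (allSubsets n) × p ∈ map (outside ∷_) (allSubsets n))
  disjoint (p∈ins , p∈outs) with _ , _ , refl ← ∈-map⁻ (inside ∷_) p∈ins | _ , _ , () ← ∈-map⁻ (outside ∷_) p∈outs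

∑-allSubsets : ∀ (F : Subset (suc n) → ℕ) →
  ∑ F (allSubsets (suc n)) ≡ ∑ (F ∘ (inside ∷_)) (allSubsets n) + ∑ (F ∘ (outside ∷_)) (allSubsets n)
∑-allSubsets {n} F = begin
  ∑ F (map (inside ∷_) (allSubsets n) ++ map (outside ∷_) (allSubsets n))
    ≡⟨ ∑-++ F (map (inside ∷_) (allSubsets n)) _ ⟩
  ∑ F (map (inside ∷_) (allSubsets n)) + ∑ F (map (outside ∷_) (allSubsets n))
    ≡⟨ cong₂ _+_ (∑-map F (inside ∷_) (allSubsets n)) (∑-map F (outside ∷_) (allSubsets n)) ⟩
  ∑ (F ∘ (inside ∷_)) (allSubsets n) + ∑ (F ∘ (outside ∷_)) (allSubsets n) ∎
  where open ≡-Reasoning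

#subsets-of-size : ∀ n m (p : Subset n) → ∑ (λ q → 𝟙 ((q ⊆? p) ×-dec (∣ q ∣ ℕ.≟ m))) (allSubsets n) ≡ ∣ p ∣ C m
#subsets-of-size zero zero    [] = refl
#subsets-of-size zero (suc m) [] = refl
#subsets-of-size (suc n) m (s ∷ p) = begin
  ∑ F (allSubsets (suc n))
    ≡⟨ ∑-allSubsets F ⟩
  ∑ (F ∘ (inside ∷_)) (allSubsets n) + ∑ (F ∘ (outside ∷_)) (allSubsets n)
    ≡⟨ cong (∑ (F ∘ (inside ∷_)) (allSubsets n) +_) (#subsets-of-size n m p) ⟩
  ∑ (F ∘ (inside ∷_)) (allSubsets n) + ∣ p ∣ C m
    ≡⟨ with-head s m ⟩
  ∣ s ∷ p ∣ C m ∎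
  where
  open ≡-Reasoning
  F : Subset (suc n) → ℕ
  F q = 𝟙 ((q ⊆? s ∷ p) ×-dec (∣ q ∣ ℕ.≟ m))
  with-head : ∀ s m → ∑ (λ q → 𝟙 ((inside ∷ q ⊆? s ∷ p) ×-dec (suc ∣ q ∣ ℕ.≟ m))) (allSubsets n) + ∣ p ∣ C m
                      ≡ ∣ s ∷ p ∣ C m
  with-head outside m       = cong (_+ ∣ p ∣ C m) (∑-zero (λ _ → refl) (allSubsets n))
  with-head inside  zero    = cong (_+ ∣ p ∣ C 0) (∑-zero (λ _ → cong (if_then 1 else 0) (∧-zeroʳ _)) (allSubsets n))
  with-head inside  (suc m) =
    trans (cong (_+ ∣ p ∣ C suc m) (#subsets-of-size n m p)) (nCk+nC[k+1]≡[n+1]C[k+1] ∣ p ∣ m)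

length-mSubsetsOf : ∀ m (p : Subset n) → length (mSubsetsOf m p) ≡ ∣ p ∣ C m
length-mSubsetsOf {n} m p =
  trans (length-filter-filter (λ q → ∣ q ∣ ℕ.≟ m) (_⊆? p) (allSubsets n)) (#subsets-of-size n m p)

∈-mSubsetsOf⁺ : ∀ {m} {p q : Subset n} → ∣ p ∣ ≡ m → p ⊆ q → p ∈ mSubsetsOf m q
∈-mSubsetsOf⁺ {m = m} {p} {q} ∣p∣≡m p⊆q =
  ∈-filter⁺ (_⊆? q) (∈-filter⁺ (λ r → ∣ r ∣ ℕ.≟ m) (∈-allSubsets p) ∣p∣≡m) p⊆q

∈-mSubsetsOf⁻ : ∀ {m} {p q : Subset n} → p ∈ mSubsetsOf m q → ∣ p ∣ ≡ m × p ⊆ q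
∈-mSubsetsOf⁻ {n} {m} {q = q} p∈ with p∈′ , p⊆q ← ∈-filter⁻ (_⊆? q) {xs = mSubsets n m} p∈ =
  proj₂ (∈-filter⁻ (λ r → ∣ r ∣ ℕ.≟ m) {xs = allSubsets n} p∈′) , p⊆q

mSubsets-unique : ∀ n m → Unique (mSubsets n m)
mSubsets-unique n m = Unique.filter⁺ (λ r → ∣ r ∣ ℕ.≟ m) (allSubsets-unique n)

mSubsetsOf-unique : ∀ m (p : Subset n) → Unique (mSubsetsOf m p)
mSubsetsOf-unique {n} m p = Unique.filter⁺ (_⊆? p) (mSubsets-unique n m)

∈-mSubsetsOf-∩ : ∀ {m} {p q r : Subset n} → p ⊆ q ∩ r → ∣ p ∣ ≡ m → p ∈ mSubsetsOf m q × p ∈ mSubsetsOf m r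
∈-mSubsetsOf-∩ {q = q} {r} p⊆q∩r ∣p∣≡m =
  ∈-mSubsetsOf⁺ ∣p∣≡m (⊆-trans p⊆q∩r (p∩q⊆p q r)) , ∈-mSubsetsOf⁺ ∣p∣≡m (⊆-trans p⊆q∩r (p∩q⊆q q r))

-- Natural numbers inside ℚ

ℕtoℚ≡mkℚ : ∀ a → ℕtoℚ a ≡ mkℚ (ℤ.+ a) 0 (Coprime.sym (Coprime.1-coprimeTo a))
ℕtoℚ≡mkℚ a = ℚ.normalize-coprime (Coprime.sym (Coprime.1-coprimeTo a))

ℕtoℚ-+ : ∀ a b → ℕtoℚ (a + b) ≡ ℕtoℚ a +ℚ ℕtoℚ b
ℕtoℚ-+ a b = trans
  (ℚ./-cong {p₂ = ℤ.+ a ℤ.* ℤ.+ 1 ℤ.+ ℤ.+ b ℤ.* ℤ.+ 1} {q₂ = 1}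
    (sym (cong₂ ℤ._+_ (ℤ.*-identityʳ (ℤ.+ a)) (ℤ.*-identityʳ (ℤ.+ b)))) refl)
  (sym (cong₂ _+ℚ_ (ℕtoℚ≡mkℚ a) (ℕtoℚ≡mkℚ b)))

ℕtoℚ-* : ∀ a b → ℕtoℚ (a * b) ≡ ℕtoℚ a *ℚ ℕtoℚ b
ℕtoℚ-* a b = trans (ℚ./-cong {p₂ = ℤ.+ a ℤ.* ℤ.+ b} {q₂ = 1} (ℤ.pos-* a b) refl)
  (sym (cong₂ _*ℚ_ (ℕtoℚ≡mkℚ a) (ℕtoℚ≡mkℚ b)))

ℕtoℚ-mono-≤ : ∀ {a b} → a ≤ b → ℕtoℚ a ≤ℚ ℕtoℚ b
ℕtoℚ-mono-≤ {a} {b} a≤b rewrite ℕtoℚ≡mkℚ a | ℕtoℚ≡mkℚ b = *≤* (ℤ.*-monoʳ-≤-nonNeg (ℤ.+ 1) (+≤+ a≤b))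

ℕtoℚ-nonNeg : ∀ a → NonNegative (ℕtoℚ a)
ℕtoℚ-nonNeg a = ℚ.normalize-nonNeg a 1

sumℚ-map-ℕtoℚ : ∀ {a} {A : Set a} (q : ℚ) (h : A → ℕ) xs →
  sumℚ (map (λ x → q *ℚ ℕtoℚ (h x)) xs) ≡ q *ℚ ℕtoℚ (∑ h xs)
sumℚ-map-ℕtoℚ q h []       = sym (ℚ.*-zeroʳ q)
sumℚ-map-ℕtoℚ q h (x ∷ xs) = begin
  q *ℚ ℕtoℚ (h x) +ℚ sumℚ (map (λ x → q *ℚ ℕtoℚ (h x)) xs) ≡⟨ cong (q *ℚ ℕtoℚ (h x) +ℚ_) (sumℚ-map-ℕtoℚ q h xs) ⟩
  q *ℚ ℕtoℚ (h x) +ℚ q *ℚ ℕtoℚ (∑ h xs)                     ≡⟨ ℚ.*-distribˡ-+ q (ℕtoℚ (h x)) _ ⟨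
  q *ℚ (ℕtoℚ (h x) +ℚ ℕtoℚ (∑ h xs))                        ≡⟨ cong (q *ℚ_) (ℕtoℚ-+ (h x) (∑ h xs)) ⟨
  q *ℚ ℕtoℚ (h x + ∑ h xs)                                  ∎
  where open ≡-Reasoning

¼ : ℚ
¼ = ℤ.+ 1 / 4

-- k / (4 * (2 + k)) is normalised by a gcd, so compare cross-products in ℚᵘ instead.
k/4[2+k]≤¼ : ∀ k → ℤ.+ k / (4 * (2 + k)) ≤ℚ ¼
k/4[2+k]≤¼ k = ℚ.toℚᵘ-cancel-≤ (ℚᵘ.≤-respˡ-≃ (ℚᵘ.≃-sym (ℚ.toℚᵘ-fromℚᵘ (ℚᵘ.mkℚᵘ (ℤ.+ k) _)))
  (ℚᵘ.*≤* (subst₂ ℤ._≤_ (ℤ.pos-* k 4) (ℤ.pos-* 1 (4 * (2 + k))) (+≤+ k*4≤1*[4*[2+k]]))))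
  where
  open ≤-Reasoning
  k*4≤1*[4*[2+k]] : k * 4 ≤ 1 * (4 * (2 + k))
  k*4≤1*[4*[2+k]] = begin
    k * 4             ≡⟨ *-comm k 4 ⟩
    4 * k             ≤⟨ *-monoʳ-≤ 4 (m≤n+m k 2) ⟩
    4 * (2 + k)       ≡⟨ *-identityˡ _ ⟨
    1 * (4 * (2 + k)) ∎

-- ¼ *ℚ ℕtoℚ 3 and 1ℚ -ℚ ¼ are the same closed rational, so they agree by computation.
¾≤bound-coefficient : ∀ k → ¼ *ℚ ℕtoℚ 3 ≤ℚ 1ℚ -ℚ ℤ.+ k / (4 * (2 + k))
¾≤bound-coefficient k = ℚ.+-monoʳ-≤ 1ℚ (ℚ.neg-antimono-≤ (k/4[2+k]≤¼ k))

¼*3Cν≤bound*ν : ∀ k ν → ¼ *ℚ ℕtoℚ (3 * ((2 * k) C k) * ν) ≤ℚ bound k *ℚ ℕtoℚ ν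
¼*3Cν≤bound*ν k ν = begin
  ¼ *ℚ ℕtoℚ (3 * binom * ν)
    ≡⟨ cong (¼ *ℚ_) (trans (ℕtoℚ-* (3 * binom) ν) (cong (_*ℚ ℕtoℚ ν) (ℕtoℚ-* 3 binom))) ⟩
  ¼ *ℚ (ℕtoℚ 3 *ℚ ℕtoℚ binom *ℚ ℕtoℚ ν)
    ≡⟨ ℚ.*-assoc ¼ (ℕtoℚ 3 *ℚ ℕtoℚ binom) (ℕtoℚ ν) ⟨
  ¼ *ℚ (ℕtoℚ 3 *ℚ ℕtoℚ binom) *ℚ ℕtoℚ ν
    ≡⟨ cong (_*ℚ ℕtoℚ ν) (ℚ.*-assoc ¼ (ℕtoℚ 3) (ℕtoℚ binom)) ⟨
  ¼ *ℚ ℕtoℚ 3 *ℚ ℕtoℚ binom *ℚ ℕtoℚ ν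
    ≤⟨ ℚ.*-monoʳ-≤-nonNeg (ℕtoℚ ν) {{ℕtoℚ-nonNeg ν}}
         (ℚ.*-monoʳ-≤-nonNeg (ℕtoℚ binom) {{ℕtoℚ-nonNeg binom}} (¾≤bound-coefficient k)) ⟩
  bound k *ℚ ℕtoℚ ν ∎
  where
  open ℚ.≤-Reasoning
  binom = (2 * k) C k

-- The fractional cover built from a maximum matching

module FractionalCover {n : ℕ} (k : ℕ) (0<k : 0 < k) (E : Hypergraph n) (uniform : Uniform (2 * k) E)
  (M : List (Subset n)) (M-matching : IsMatching k E M)
  (M-maximum : ∀ M′ → IsMatching k E M′ → length M′ ≤ length M) where

  infix 4 _≟ₛ_
  _≟ₛ_ : DecidableEquality (Subset n)
  _≟ₛ_ = Vec-≡-dec Bool._≟_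

  open import Data.List.Membership.DecPropositional _≟ₛ_ using (_∈?_)

  private variable
    e f h x y A B : Subset n

  M-edge : f ∈ M → IsEdge E f
  M-edge = All.lookup (proj₁ M-matching)

  M-unique : Unique M
  M-unique = AllPairs.map proj₁ (proj₂ M-matching)

  Apart : Subset n → Subset n → Set
  Apart e e′ = e ≢ e′ × ∣ e ∩ e′ ∣ < k

  apart : IsEdge E e → ∣ e ∩ h ∣ < k → Apart e h
  apart {e} Ee ∣e∩h∣<k = e≢h , ∣e∩h∣<k
    where
    e≢h : e ≢ _
    e≢h refl = <⇒≱ ∣e∩h∣<k (subst (k ≤_) (sym (trans (cong ∣_∣ (∩-idem e)) (uniform e Ee))) (m≤m+n k _))

  conflicts : Subset n → List (Subset n)
  conflicts e = filter (λ h → k ≤? ∣ e ∩ h ∣) M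

  ∈conflicts⁻ : h ∈ conflicts e → h ∈ M × k ≤ ∣ e ∩ h ∣
  ∈conflicts⁻ {e = e} = ∈-filter⁻ (λ h → k ≤? ∣ e ∩ h ∣) {xs = M}

  ∉conflicts⇒<k : h ∈ M → h ∉ conflicts e → ∣ e ∩ h ∣ < k
  ∉conflicts⇒<k h∈M h∉ = ≰⇒> (h∉ ∘ ∈-filter⁺ _ h∈M)

  conflicts-nonempty : IsEdge E e → conflicts e ≢ []
  conflicts-nonempty {e} Ee none = 1+n≰n (M-maximum (e ∷ M) (Ee ∷ proj₁ M-matching , e-apart ∷ proj₂ M-matching))
    where
    e-apart : All (Apart e) M
    e-apart = All.tabulate λ h∈M → apart Ee (∉conflicts⇒<k {e = e} h∈M (¬Any[] ∘ subst (_ ∈_) none))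

  Anchored : Subset n → Subset n → Subset n → Set
  Anchored f A e = IsEdge E e × e ∩ f ≡ A × conflicts e ≡ f ∷ []

  anchored? : ∀ f A → Dec (∃ (Anchored f A))
  anchored? f A = anySubset? λ e →
    (E e Bool.≟ true) ×-dec (e ∩ f ≟ₛ A) ×-dec List-≡-dec _≟ₛ_ (conflicts e) (f ∷ [])

  anchored⇒∈M : Anchored f A e → f ∈ M
  anchored⇒∈M {f} {e = e} (_ , _ , only-f) = proj₁ (∈conflicts⁻ {e = e} (subst (f ∈_) (sym only-f) (here refl)))

  ∣p∩∁q∣≡k : ∀ (p q : Subset n) → ∣ p ∣ ≡ 2 * k → ∣ p ∩ q ∣ ≡ k → ∣ p ∩ ∁ q ∣ ≡ k
  ∣p∩∁q∣≡k p q ∣p∣≡2k ∣p∩q∣≡k = +-cancelˡ-≡ k _ _ (begin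
    k + ∣ p ∩ ∁ q ∣         ≡⟨ cong (_+ ∣ p ∩ ∁ q ∣) ∣p∩q∣≡k ⟨
    ∣ p ∩ q ∣ + ∣ p ∩ ∁ q ∣ ≡⟨ ∣p∣≡∣p∩q∣+∣p∩∁q∣ p q ⟨
    ∣ p ∣                   ≡⟨ ∣p∣≡2k ⟩
    2 * k                   ≡⟨ cong (k +_) (+-identityʳ k) ⟩
    k + k                   ∎)
    where open ≡-Reasoning

  anchored-pair-conflict : Anchored f A x → Anchored f B y → x ≢ y → k ≤ ∣ x ∩ y ∣
  anchored-pair-conflict {f} {x = x} {y = y} (Ex , _ , only-f-x) (Ey , _ , only-f-y) x≢y with k ≤? ∣ x ∩ y ∣
  ... | yes k≤∣x∩y∣ = k≤∣x∩y∣
  ... | no  k≰∣x∩y∣ = contradiction (M-maximum (x ∷ y ∷ rest) (edges , pairs)) (<⇒≱ longer)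
    where
    rest = filter (∁? (λ h → k ≤? ∣ x ∩ h ∣)) M
    ∈rest⁻ : h ∈ rest → h ∈ M × ¬ k ≤ ∣ x ∩ h ∣
    ∈rest⁻ = ∈-filter⁻ (∁? (λ h → k ≤? ∣ x ∩ h ∣))
    k≤∣x∩f∣ : k ≤ ∣ x ∩ f ∣
    k≤∣x∩f∣ = proj₂ (∈conflicts⁻ {e = x} (subst (f ∈_) (sym only-f-x) (here refl)))
    y-apart : h ∈ rest → Apart y h
    y-apart {h} h∈ with h∈M , k≰∣x∩h∣ ← ∈rest⁻ h∈ = apart Ey (∉conflicts⇒<k {e = y} h∈M h∉)
      where
      h∉ : h ∉ conflicts y
      h∉ h∈c with here refl ← subst (h ∈_) only-f-y h∈c = k≰∣x∩h∣ k≤∣x∩f∣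
    edges : All (IsEdge E) (x ∷ y ∷ rest)
    edges = Ex ∷ Ey ∷ All.tabulate (M-edge ∘ proj₁ ∘ ∈rest⁻)
    pairs : AllPairs Apart (x ∷ y ∷ rest)
    pairs = ((x≢y , ≰⇒> k≰∣x∩y∣) ∷ All.tabulate (λ h∈ → apart Ex (≰⇒> (proj₂ (∈rest⁻ h∈)))))
          ∷ All.tabulate y-apart
          ∷ AllPairs.filter⁺ _ (proj₂ M-matching)
    longer : length M < length (x ∷ y ∷ rest)
    longer = ≤-reflexive (cong suc (begin
      length M                                ≡⟨ length-filter+length-filter-∁ (λ h → k ≤? ∣ x ∩ h ∣) M ⟨
      length (conflicts x) + length rest      ≡⟨ cong (λ c → length c + length rest) only-f-x ⟩
      suc (length rest)                       ∎))
      where open ≡-Reasoning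

  complement-∈-mSubsetsOf : f ∈ M → A ∈ mSubsetsOf k f → f ∩ ∁ A ∈ mSubsetsOf k f
  complement-∈-mSubsetsOf {f} {A} f∈M A∈ with ∣A∣≡k , A⊆f ← ∈-mSubsetsOf⁻ A∈ =
    ∈-mSubsetsOf⁺ (∣p∩∁q∣≡k f A (uniform f (M-edge f∈M)) (trans (cong ∣_∣ (p⊆q⇒q∩p≡p A⊆f)) ∣A∣≡k)) (p∩q⊆p f (∁ A))

  ≢complement : A ∈ mSubsetsOf k f → A ≢ f ∩ ∁ A
  ≢complement {f = f} A∈ = p≢q∩∁p f (subst (0 <_) (sym (proj₁ (∈-mSubsetsOf⁻ A∈))) 0<k)

  anchored-outsides-agree : A ∈ mSubsetsOf k f → Anchored f A x → Anchored f (f ∩ ∁ A) y → x ∩ ∁ f ≡ y ∩ ∁ f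
  anchored-outsides-agree {A} {f} {x} {y} A∈ ax@(Ex , x∩f≡A , _) ay@(Ey , y∩f≡f∖A , _) =
    ∣p∣⊔∣q∣≤∣p∩q∣⇒p≡q (begin
      ∣ x ∩ ∁ f ∣ ⊔ ∣ y ∩ ∁ f ∣                           ≡⟨ cong₂ _⊔_ ∣x∖f∣≡k ∣y∖f∣≡k ⟩
      k ⊔ k                                               ≡⟨ ⊔-idem k ⟩
      k                                                   ≤⟨ anchored-pair-conflict ax ay x≢y ⟩
      ∣ x ∩ y ∣                                           ≡⟨ ∣p∩q∣≡∣p∩r∩q∩r∣+∣p∩∁r∩q∩∁r∣ x y f ⟩
      ∣ (x ∩ f) ∩ (y ∩ f) ∣ + ∣ (x ∩ ∁ f) ∩ (y ∩ ∁ f) ∣ ≡⟨ cong (_+ ∣ (x ∩ ∁ f) ∩ (y ∩ ∁ f) ∣) ∣A∩[f∖A]∣≡0 ⟩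
      ∣ (x ∩ ∁ f) ∩ (y ∩ ∁ f) ∣                           ∎)
    where
    open ≤-Reasoning
    f∖A∈ = complement-∈-mSubsetsOf (anchored⇒∈M ax) A∈
    ∣x∖f∣≡k = ∣p∩∁q∣≡k x f (uniform x Ex) (trans (cong ∣_∣ x∩f≡A) (proj₁ (∈-mSubsetsOf⁻ A∈)))
    ∣y∖f∣≡k = ∣p∩∁q∣≡k y f (uniform y Ey) (trans (cong ∣_∣ y∩f≡f∖A) (proj₁ (∈-mSubsetsOf⁻ f∖A∈)))
    x≢y : x ≢ y
    x≢y refl = ≢complement A∈ (trans (sym x∩f≡A) y∩f≡f∖A)
    ∣A∩[f∖A]∣≡0 : ∣ (x ∩ f) ∩ (y ∩ f) ∣ ≡ 0
    ∣A∩[f∖A]∣≡0 = begin-equality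
      ∣ (x ∩ f) ∩ (y ∩ f) ∣ ≡⟨ cong₂ (λ p q → ∣ p ∩ q ∣) x∩f≡A y∩f≡f∖A ⟩
      ∣ A ∩ (f ∩ ∁ A) ∣     ≡⟨ cong ∣_∣ (p∩q∩∁p≡⊥ A f) ⟩
      ∣ ⊥ {n} ∣             ≡⟨ ∣⊥∣≡0 n ⟩
      0                     ∎

  -- By anchored-outsides-agree, x ∩ ∁ f does not depend on the chosen anchored edge x.
  bonus : Subset n → Subset n → Subset n
  bonus f A with anchored? f A | anchored? f (f ∩ ∁ A)
  ... | yes (x , _) | yes _ = x ∩ ∁ f
  ... | yes _       | no _  = A
  ... | no _        | _     = f ∩ ∁ A

  module _ {e f A : Subset n} (A∈ : A ∈ mSubsetsOf k f) (ae : Anchored f A e) where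

    anchor-∈ : A ∈ mSubsetsOf k e
    anchor-∈ = ∈-mSubsetsOf⁺ (proj₁ (∈-mSubsetsOf⁻ A∈)) (subst (_⊆ e) (proj₁ (proj₂ ae)) (p∩q⊆p e f))

    private
      e∖f∈mSubsetsOf-e : e ∩ ∁ f ∈ mSubsetsOf k e
      e∖f∈mSubsetsOf-e = ∈-mSubsetsOf⁺ ∣e∖f∣≡k (p∩q⊆p e (∁ f))
        where
        ∣e∖f∣≡k = ∣p∩∁q∣≡k e f (uniform e (proj₁ ae)) (trans (cong ∣_∣ (proj₁ (proj₂ ae))) (proj₁ (∈-mSubsetsOf⁻ A∈)))

      f∖[f∖A]≡A : f ∩ ∁ (f ∩ ∁ A) ≡ A
      f∖[f∖A]≡A = p⊆q⇒q∩∁[q∩∁p]≡p (proj₂ (∈-mSubsetsOf⁻ A∈))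

    bonus-∈ : bonus f A ∈ mSubsetsOf k e
    bonus-∈ with anchored? f A | anchored? f (f ∩ ∁ A)
    ... | yes (x , ax) | yes (y , ay) = subst (_∈ mSubsetsOf k e)
          (trans (anchored-outsides-agree A∈ ae ay) (sym (anchored-outsides-agree A∈ ax ay))) e∖f∈mSubsetsOf-e
    ... | yes _        | no _         = anchor-∈
    ... | no none      | _            = contradiction (e , ae) none

    bonus-complement-∈ : bonus f (f ∩ ∁ A) ∈ mSubsetsOf k e
    bonus-complement-∈ with anchored? f (f ∩ ∁ A) | anchored? f (f ∩ ∁ (f ∩ ∁ A))
    ... | yes (y , ay) | yes _ = subst (_∈ mSubsetsOf k e) (anchored-outsides-agree A∈ ae ay) e∖f∈mSubsetsOf-e
    ... | yes _        | no none = contradiction (e , subst (λ B → Anchored f B e) (sym f∖[f∖A]≡A) ae) none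
    ... | no _         | _ = subst (_∈ mSubsetsOf k e) (sym f∖[f∖A]≡A) anchor-∈

  load : Subset n → Subset n → Subset n → ℕ
  load f A S = 2 * 𝟙 (A ≟ₛ S) + 𝟙 (bonus f A ≟ₛ S)

  weight : Subset n → ℕ
  weight S = ∑ (λ f → ∑ (λ A → load f A S) (mSubsetsOf k f)) M

  hits : List (Subset n) → Subset n → Subset n → ℕ
  hits L f A = 2 * 𝟙 (A ∈? L) + 𝟙 (bonus f A ∈? L)

  charge : List (Subset n) → Subset n → ℕ
  charge L f = ∑ (hits L f) (mSubsetsOf k f)

  ∑-weight : ∀ {L} → Unique L → ∑ weight L ≡ ∑ (charge L) M
  ∑-weight {L} L! = begin
    ∑ weight L
      ≡⟨ ∑-comm (λ S f → ∑ (λ A → load f A S) (mSubsetsOf k f)) L M ⟩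
    ∑ (λ f → ∑ (λ S → ∑ (λ A → load f A S) (mSubsetsOf k f)) L) M
      ≡⟨ ∑-cong (λ f → ∑-comm (λ S A → load f A S) L (mSubsetsOf k f)) M ⟩
    ∑ (λ f → ∑ (λ A → ∑ (load f A) L) (mSubsetsOf k f)) M
      ≡⟨ ∑-cong (λ f → ∑-cong (∑-load f) (mSubsetsOf k f)) M ⟩
    ∑ (charge L) M ∎
    where
    open ≡-Reasoning
    ∑-load : ∀ f A → ∑ (load f A) L ≡ hits L f A
    ∑-load f A = begin
      ∑ (load f A) L
        ≡⟨ ∑-+ _ _ L ⟩
      ∑ (λ S → 2 * 𝟙 (A ≟ₛ S)) L + ∑ (λ S → 𝟙 (bonus f A ≟ₛ S)) L
        ≡⟨ cong (_+ ∑ (λ S → 𝟙 (bonus f A ≟ₛ S)) L) (∑-*ˡ 2 (λ S → 𝟙 (A ≟ₛ S)) L) ⟩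
      2 * ∑ (λ S → 𝟙 (A ≟ₛ S)) L + ∑ (λ S → 𝟙 (bonus f A ≟ₛ S)) L
        ≡⟨ cong₂ (λ a b → 2 * a + b) (∑-𝟙-≟ _≟ₛ_ A L!) (∑-𝟙-≟ _≟ₛ_ (bonus f A) L!) ⟩
      hits L f A ∎

  hits-≤3 : ∀ L f A → hits L f A ≤ 3
  hits-≤3 L f A = +-mono-≤ (*-monoʳ-≤ 2 (𝟙≤1 (A ∈? L))) (𝟙≤1 (bonus f A ∈? L))

  hits-≥2 : ∀ {L} f {A} → A ∈ L → 2 ≤ hits L f A
  hits-≥2 {L} f {A} A∈L rewrite 𝟙≡1 (A ∈? L) A∈L = m≤m+n 2 _

  charge-≥2 : ∀ {L} → A ∈ mSubsetsOf k f → A ∈ L → 2 ≤ charge L f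
  charge-≥2 {f = f} A∈ A∈L = ≤-trans (hits-≥2 f A∈L) (∈⇒≤∑ _ A∈)

  charge-≥2-of-conflict : f ∈ conflicts e → 2 ≤ charge (mSubsetsOf k e) f
  charge-≥2-of-conflict {f} {e} f∈
    with q , q⊆e∩f , ∣q∣≡k ← subset-of-size (e ∩ f) (proj₂ (∈conflicts⁻ {e = e} f∈))
    with q∈e , q∈f ← ∈-mSubsetsOf-∩ q⊆e∩f ∣q∣≡k = charge-≥2 q∈f q∈e

  charge-heavy : k < ∣ e ∩ f ∣ → 4 ≤ charge (mSubsetsOf k e) f
  charge-heavy {e} {f} k<∣e∩f∣
    with q , r , q≢r , (q⊆e∩f , ∣q∣≡k) , (r⊆e∩f , ∣r∣≡k) ← two-subsets-of-size (e ∩ f) 0<k k<∣e∩f∣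
    with q∈e , q∈f ← ∈-mSubsetsOf-∩ q⊆e∩f ∣q∣≡k
    with r∈e , r∈f ← ∈-mSubsetsOf-∩ r⊆e∩f ∣r∣≡k =
    ≤-trans (+-mono-≤ (hits-≥2 f q∈e) (hits-≥2 f r∈e)) (∑-pair _ (mSubsetsOf-unique k f) q∈f r∈f q≢r)

  charge-anchored : A ∈ mSubsetsOf k f → Anchored f A e → 4 ≤ charge (mSubsetsOf k e) f
  charge-anchored {A} {f} {e} A∈ ae = ≤-trans (+-mono-≤ hits-A hits-f∖A)
    (∑-pair _ (mSubsetsOf-unique k f) A∈ (complement-∈-mSubsetsOf (anchored⇒∈M ae) A∈) (≢complement A∈))
    where
    Le = mSubsetsOf k e
    hits-A : 3 ≤ hits Le f A
    hits-A rewrite 𝟙≡1 (A ∈? Le) (anchor-∈ A∈ ae) | 𝟙≡1 (bonus f A ∈? Le) (bonus-∈ A∈ ae) = ≤-refl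
    hits-f∖A : 1 ≤ hits Le f (f ∩ ∁ A)
    hits-f∖A rewrite 𝟙≡1 (bonus f (f ∩ ∁ A) ∈? Le) (bonus-complement-∈ A∈ ae) = m≤n+m 1 _

  weight-covers : IsEdge E e → 4 ≤ ∑ weight (mSubsetsOf k e)
  weight-covers {e} Ee rewrite ∑-weight (mSubsetsOf-unique k e) with conflicts e in only
  ... | [] = contradiction only (conflicts-nonempty Ee)
  ... | f ∷ h ∷ _ with (f≢h ∷ _) ∷ _ ← subst Unique only (Unique.filter⁺ _ M-unique) =
    ≤-trans (+-mono-≤ (charge-≥2-of-conflict f∈) (charge-≥2-of-conflict h∈))
            (∑-pair _ M-unique (proj₁ (∈conflicts⁻ {e = e} f∈)) (proj₁ (∈conflicts⁻ {e = e} h∈)) f≢h)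
    where
    f∈ = subst (f ∈_) (sym only) (here refl)
    h∈ = subst (h ∈_) (sym only) (there (here refl))
  ... | f ∷ [] with f∈M , k≤∣e∩f∣ ← ∈conflicts⁻ {e = e} (subst (f ∈_) (sym only) (here refl)) with k <? ∣ e ∩ f ∣
  ...   | yes k<∣e∩f∣ = ≤-trans (charge-heavy k<∣e∩f∣) (∈⇒≤∑ _ f∈M)
  ...   | no  k≮∣e∩f∣ = ≤-trans (charge-anchored e∩f∈ (Ee , refl , only)) (∈⇒≤∑ _ f∈M)
    where
    e∩f∈ : e ∩ f ∈ mSubsetsOf k f
    e∩f∈ = ∈-mSubsetsOf⁺ (≤-antisym (≮⇒≥ k≮∣e∩f∣) k≤∣e∩f∣) (p∩q⊆q e f)

  weight-total : ∑ weight (mSubsets n k) ≤ 3 * ((2 * k) C k) * length M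
  weight-total = begin
    ∑ weight (mSubsets n k)        ≡⟨ ∑-weight (mSubsets-unique n k) ⟩
    ∑ (charge (mSubsets n k)) M    ≤⟨ ∑-bounded M charge≤ ⟩
    3 * ((2 * k) C k) * length M   ∎
    where
    open ≤-Reasoning
    charge≤ : f ∈ M → charge (mSubsets n k) f ≤ 3 * ((2 * k) C k)
    charge≤ {f} f∈M = begin
      charge (mSubsets n k) f         ≤⟨ ∑-bounded (mSubsetsOf k f) (λ _ → hits-≤3 (mSubsets n k) f _) ⟩
      3 * length (mSubsetsOf k f)     ≡⟨ cong (3 *_) (length-mSubsetsOf k f) ⟩
      3 * (∣ f ∣ C k)                 ≡⟨ cong (λ m → 3 * (m C k)) (uniform f (M-edge f∈M)) ⟩
      3 * ((2 * k) C k)               ∎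

corollary3 : (k : ℕ) → 2 ≤ k → (n : ℕ) (E : Hypergraph n) → Uniform (2 * k) E → HasEdge E
    → (ν : ℕ) → IsMaxMatchingSize k E ν
    → Σ (Subset n → ℚ) λ c → IsFractionalCover k E c × (coverSize k c ≤ℚ (bound k *ℚ ℕtoℚ ν))
corollary3 k 2≤k n E uniform _ ν ((M , M-matching , refl) , M-maximum) = c , (c≥0 , c-covers) , c-size
  where
  open FractionalCover k (≤-trans (s≤s z≤n) 2≤k) E uniform M M-matching M-maximum

  c : Subset n → ℚ
  c S = ¼ *ℚ ℕtoℚ (weight S)

  -- ¼ *ℚ ℕtoℚ 0 and ¼ *ℚ ℕtoℚ 4 compute to 0ℚ and 1ℚ.
  c≥0 : ∀ S → 0ℚ ≤ℚ c S
  c≥0 S = ℚ.*-monoˡ-≤-nonNeg ¼ (ℕtoℚ-mono-≤ {0} {weight S} z≤n)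

  c-covers : ∀ e → IsEdge E e → 1ℚ ≤ℚ sumℚ (map c (mSubsetsOf k e))
  c-covers e Ee = subst (1ℚ ≤ℚ_) (sym (sumℚ-map-ℕtoℚ ¼ weight (mSubsetsOf k e)))
    (ℚ.*-monoˡ-≤-nonNeg ¼ (ℕtoℚ-mono-≤ (weight-covers Ee)))

  c-size : coverSize k c ≤ℚ bound k *ℚ ℕtoℚ (length M)
  c-size = begin
    coverSize k c                             ≡⟨ sumℚ-map-ℕtoℚ ¼ weight (mSubsets n k) ⟩
    ¼ *ℚ ℕtoℚ (∑ weight (mSubsets n k))       ≤⟨ ℚ.*-monoˡ-≤-nonNeg ¼ (ℕtoℚ-mono-≤ weight-total) ⟩
    ¼ *ℚ ℕtoℚ (3 * ((2 * k) C k) * length M)  ≤⟨ ¼*3Cν≤bound*ν k (length M) ⟩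
    bound k *ℚ ℕtoℚ (length M)                ∎
    where open ℚ.≤-Reasoning
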